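{- For every positive integer $j$, every $(2,j)$ phylogeny graph is $(j+2)$-degenerate.
   Context: All digraphs are finite and simple. A $(2,j)$ digraph is an acyclic digraph in which every vertex has indegree at most $2$ and outdegree at most $j$. For an acyclic digraph $D$, the phylogeny graph $P(D)$ has vertex set $V(D)$, with $u\ne v$ adjacent iff $(u,v)\in A(D)$, or $(v,u)\in A(D)$, or $u$ and $v$ have a common out-neighbor in $D$. A graph is a $(2,j)$ phylogeny graph if it is isomorphic to $P(D)$ for some $(2,j)$ digraph $D$. A graph $G$ is $k$-degenerate if every subgraph of $G$ contains a vertex having at most $k$ neighbors in that subgraph. -}

module Defs where

open import Data.Nat using (ℕ; _+_; _≤_)
open import Data.Fin using (Fin)
open import Data.Bool using (Bool; true; false; T; _∧_; _∨_; if_then_else_)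
open import Data.List using (List; foldr; map; allFin)
open import Data.Product using (Σ; ∃; _×_)
open import Data.Sum using (_⊎_)
open import Relation.Nullary using (¬_)
open import Relation.Binary.PropositionalEquality using (_≡_; _≢_)
open import Relation.Binary.Construct.Closure.Transitive using (TransClosure)
open import Function.Bundles using (_↔_; Inverse)

countB : ∀ {n} → (Fin n → Bool) → ℕ
countB {n} p = foldr (λ v acc → (if p v then 1 else 0) + acc) 0 (allFin n)

-- Digraphs on vertex set Fin n: arc relation given by a Boolean matrix
-- (A u v = true  iff  (u,v) is an arc).  Simple: no loops; multiple arcs
-- are impossible by construction.

record Digraph (n : ℕ) : Set where
  field
    arc     : Fin n → Fin n → Bool
    loopless : ∀ v → arc v v ≡ false
open Digraph public

Arc : ∀ {n} → Digraph n → Fin n → Fin n → Set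
Arc D u v = T (arc D u v)

Acyclic : ∀ {n} → Digraph n → Set
Acyclic {n} D = ∀ (v : Fin n) → ¬ TransClosure (Arc D) v v

indeg : ∀ {n} → Digraph n → Fin n → ℕ
indeg D v = countB (λ u → arc D u v)

outdeg : ∀ {n} → Digraph n → Fin n → ℕ
outdeg D u = countB (λ v → arc D u v)

Is2j : ℕ → ∀ {n} → Digraph n → Set
Is2j j {n} D = Acyclic D × (∀ (v : Fin n) → indeg D v ≤ 2 × outdeg D v ≤ j)

record Graph (n : ℕ) : Set where
  field
    adj    : Fin n → Fin n → Bool
    irrefl : ∀ v → adj v v ≡ false
    sym    : ∀ u v → adj u v ≡ adj v u
open Graph public

Adj : ∀ {n} → Graph n → Fin n → Fin n → Set
Adj G u v = T (adj G u v)

PhyAdj : ∀ {n} → Digraph n → Fin n → Fin n → Set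
PhyAdj D u v = u ≢ v × (Arc D u v ⊎ Arc D v u ⊎ ∃ (λ w → Arc D u w × Arc D v w))

IsoToPhylogeny : ∀ {m n} → Graph m → Digraph n → Set
IsoToPhylogeny {m} {n} G D =
  Σ (Fin m ↔ Fin n) λ σ →
    ∀ (u v : Fin m) →
      (Adj G u v → PhyAdj D (Inverse.to σ u) (Inverse.to σ v)) ×
      (PhyAdj D (Inverse.to σ u) (Inverse.to σ v) → Adj G u v)

Is2jPhylogenyGraph : ℕ → ∀ {m} → Graph m → Set
Is2jPhylogenyGraph j {m} G =
  Σ ℕ λ n → Σ (Digraph n) λ D → Is2j j D × IsoToPhylogeny G D

record Subgraph {n : ℕ} (G : Graph n) : Set where
  field
    vset   : Fin n → Bool
    eset   : Fin n → Fin n → Bool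
    sub    : ∀ u v → T (eset u v) → T (adj G u v)
    ends   : ∀ u v → T (eset u v) → T (vset u) × T (vset v)
    esym   : ∀ u v → eset u v ≡ eset v u
open Subgraph public

degIn : ∀ {n} {G : Graph n} → Subgraph G → Fin n → ℕ
degIn H v = countB (λ u → eset H v u)

Degenerate : ℕ → ∀ {n} → Graph n → Set
Degenerate k {n} G =
  ∀ (H : Subgraph G) → ∃ (λ (x : Fin n) → T (vset H x)) →
    ∃ λ (v : Fin n) → T (vset H v) × degIn H v ≤ k

-- Let G ≅ P(D) with D a (2,j) digraph and let H be a nonempty subgraph of G,
-- viewed through the isomorphism as a vertex set S of D.  Since D is acyclic,
-- S contains a sink x of S: a vertex with no out-neighbour inside S.  Every
-- P(D)-neighbour y ∈ S of x is therefore either an in-neighbour of x (at most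
-- indeg x ≤ 2 of them) or a co-parent of x, i.e. another in-neighbour of some
-- out-neighbour w of x.  As indeg w ≤ 2, each w contributes at most one
-- co-parent, so there are at most outdeg x ≤ j co-parents; hence the vertex of
-- H corresponding to x has degree at most j + 2 in H.
module Submission where

open import Defs
open import Data.Nat using (ℕ; _+_; _≤_; suc; zero; _<_; s≤s; z≤n)
open import Data.Nat.Properties
  using (≤-trans; ≤-reflexive; +-comm; +-mono-≤; ≤-pred; m≤n⇒m<n∨m≡n; n<1+n; module ≤-Reasoning)
open import Data.Fin using (Fin; toℕ; _≟_)
open import Data.Fin.Properties using (any?; pigeonhole)
open import Data.Bool using (Bool; true; false; T; if_then_else_)
open import Data.List using (List; []; _∷_; _++_; length; foldr; map; allFin; filter; filterᵇ; concatMap)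
open import Data.List.Properties using (length-++; length-map)
open import Data.List.Membership.Propositional using (_∈_; lose)
open import Data.List.Membership.Propositional.Properties
  using (∈-allFin; ∈-map⁻; ∈-++⁺ˡ; ∈-++⁺ʳ; ∈-filter⁺; ∈-filter⁻; ∈-concatMap⁺)
open import Data.List.Relation.Unary.Any using (here; there)
open import Data.List.Relation.Unary.All as All using (All)
open import Data.List.Relation.Unary.AllPairs using (_∷_)
open import Data.List.Relation.Unary.Unique.Propositional using (Unique)
import Data.List.Relation.Unary.Unique.Propositional.Properties as Unique
open import Data.Product using (∃; _×_; _,_; proj₁; proj₂)
open import Data.Sum using (inj₁; inj₂)
open import Data.Empty using (⊥-elim)
open import Relation.Nullary using (¬_; Dec; yes; no; ¬?)
open import Relation.Nullary.Decidable using (_×-dec_)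
open import Relation.Nullary.Decidable.Core using (T?)
open import Relation.Binary.PropositionalEquality
  using (_≡_; _≢_; refl; subst; cong; module ≡-Reasoning) renaming (sym to ≡-sym)
open import Relation.Binary.Construct.Closure.Transitive using (TransClosure; [_]; _∷ʳ_)
open import Function.Bundles using (Inverse; Injection)
open import Function.Properties.Inverse using (Inverse⇒Injection)

countB≡length-filter : ∀ {n} (p : Fin n → Bool) → countB p ≡ length (filterᵇ p (allFin n))
countB≡length-filter {n} p = go (allFin n)
  where
  go : ∀ xs → foldr (λ v acc → (if p v then 1 else 0) + acc) 0 xs ≡ length (filterᵇ p xs)
  go [] = refl
  go (x ∷ xs) with p x
  ... | true  = cong suc (go xs)
  ... | false = go xs

module _ {A : Set} where

  remove : ∀ {x : A} {ys} → x ∈ ys → List A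
  remove {ys = _ ∷ ys} (here _)  = ys
  remove {ys = y ∷ _}  (there p) = y ∷ remove p

  length-remove : ∀ {x : A} {ys} (p : x ∈ ys) → suc (length (remove p)) ≡ length ys
  length-remove (here _)  = refl
  length-remove (there p) = cong suc (length-remove p)

  ∈-remove : ∀ {x a : A} {ys} (p : x ∈ ys) → a ∈ ys → x ≢ a → a ∈ remove p
  ∈-remove (here refl) (here refl) x≢a = ⊥-elim (x≢a refl)
  ∈-remove (there p)   (here refl) _   = here refl
  ∈-remove (here _)    (there q)   _   = q
  ∈-remove (there p)   (there q)   x≢a = there (∈-remove p q x≢a)

  unique-⊆⇒length-≤ : ∀ {xs} → Unique xs → ∀ ys → (∀ {a} → a ∈ xs → a ∈ ys) →
                      length xs ≤ length ys
  unique-⊆⇒length-≤ {[]}     _             _  _  = z≤n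
  unique-⊆⇒length-≤ {x ∷ xs} (x∉xs ∷ uniq) ys xs⊆ys =
    ≤-trans (s≤s (unique-⊆⇒length-≤ uniq (remove x∈ys) xs⊆ys-x)) (≤-reflexive (length-remove x∈ys))
    where
    x∈ys : x ∈ ys
    x∈ys = xs⊆ys (here refl)
    xs⊆ys-x : ∀ {a} → a ∈ xs → a ∈ remove x∈ys
    xs⊆ys-x a∈xs = ∈-remove x∈ys (xs⊆ys (there a∈xs)) (All.lookup x∉xs a∈xs)

  length-concatMap-≤ : ∀ {B : Set} (f : A → List B) ws → (∀ {w} → w ∈ ws → length (f w) ≤ 1) →
                       length (concatMap f ws) ≤ length ws
  length-concatMap-≤ f []       _     = z≤n
  length-concatMap-≤ f (w ∷ ws) short =
    ≤-trans (≤-reflexive (length-++ (f w)))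
            (+-mono-≤ (short (here refl)) (length-concatMap-≤ f ws (λ w∈ws → short (there w∈ws))))

-- A relation on a finite set in which every element of a nonempty set P has
-- an R-successor in P contains a cycle: iterate the successor map and apply
-- the pigeonhole principle to the first n+1 steps.
endless⇒cycle : ∀ {n} {R : Fin n → Fin n → Set} {P : Fin n → Set} →
                (∀ x → P x → ∃ λ y → P y × R x y) →
                ∀ {x₀} → P x₀ → ∃ λ v → TransClosure R v v
endless⇒cycle {n} {R} {P} next {x₀} Px₀ =
  let (i , k , i<k , same) = pigeonhole (n<1+n n) (λ i → point (toℕ i))
  in point (toℕ i) , subst (TransClosure R (point (toℕ i))) (≡-sym same) (walk i<k)
  where
  trail : ℕ → ∃ P
  trail zero    = x₀ , Px₀
  trail (suc t) = let (y , Py , _) = next (proj₁ (trail t)) (proj₂ (trail t)) in y , Py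

  point : ℕ → Fin n
  point t = proj₁ (trail t)

  step : ∀ t → R (point t) (point (suc t))
  step t = proj₂ (proj₂ (next (point t) (proj₂ (trail t))))

  walk : ∀ {a b} → a < b → TransClosure R (point a) (point b)
  walk {a} {suc b} (s≤s a≤b) with m≤n⇒m<n∨m≡n a≤b
  ... | inj₁ a<b  = walk a<b ∷ʳ step b
  ... | inj₂ refl = [ step a ]

SinkOf : ∀ {n} → Digraph n → (Fin n → Bool) → Fin n → Set
SinkOf D S x = T (S x) × (∀ y → T (S y) → ¬ Arc D x y)

sink-exists : ∀ {n} (D : Digraph n) → Acyclic D → (S : Fin n → Bool) →
              ∀ {x₀} → T (S x₀) → ∃ (SinkOf D S)
sink-exists D acyclic S {x₀} x₀∈S with any? (λ x → T? (S x) ×-dec ¬? (hasSuccIn x))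
  where
  hasSuccIn : ∀ x → Dec (∃ λ y → T (S y) × Arc D x y)
  hasSuccIn x = any? (λ y → T? (S y) ×-dec T? (arc D x y))
... | yes (x , x∈S , noSucc) = x , x∈S , λ y y∈S x→y → noSucc (y , y∈S , x→y)
... | no  noSink = ⊥-elim (acyclic _ (proj₂ (endless⇒cycle next x₀∈S)))
  where
  next : ∀ x → T (S x) → ∃ λ y → T (S y) × Arc D x y
  next x x∈S with any? (λ y → T? (S y) ×-dec T? (arc D x y))
  ... | yes succ = succ
  ... | no  none = ⊥-elim (noSink (x , x∈S , none))

module _ {n} (D : Digraph n) where

  inNbrs outNbrs : Fin n → List (Fin n)
  inNbrs  x = filterᵇ (λ y → arc D y x) (allFin n)
  outNbrs x = filterᵇ (arc D x) (allFin n)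

  length-inNbrs : ∀ x → length (inNbrs x) ≡ indeg D x
  length-inNbrs x = ≡-sym (countB≡length-filter (λ y → arc D y x))

  length-outNbrs : ∀ x → length (outNbrs x) ≡ outdeg D x
  length-outNbrs x = ≡-sym (countB≡length-filter (arc D x))

  ∈-inNbrs⁺ : ∀ {x y} → Arc D y x → y ∈ inNbrs x
  ∈-inNbrs⁺ {x} {y} = ∈-filter⁺ (λ z → T? (arc D z x)) (∈-allFin y)

  ∈-outNbrs⁺ : ∀ {x w} → Arc D x w → w ∈ outNbrs x
  ∈-outNbrs⁺ {x} {w} = ∈-filter⁺ (λ z → T? (arc D x z)) (∈-allFin w)

  ∈-outNbrs⁻ : ∀ {x w} → w ∈ outNbrs x → Arc D x w
  ∈-outNbrs⁻ {x} w∈ = proj₂ (∈-filter⁻ (λ z → T? (arc D x z)) {xs = allFin n} w∈)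

  IsOtherParent : Fin n → Fin n → Fin n → Set
  IsOtherParent x w y = Arc D y w × y ≢ x

  otherParent? : ∀ x w y → Dec (IsOtherParent x w y)
  otherParent? x w y = T? (arc D y w) ×-dec ¬? (y ≟ x)

  otherParents : Fin n → Fin n → List (Fin n)
  otherParents x w = filter (otherParent? x w) (allFin n)

  ∈-otherParents⁺ : ∀ {x w y} → IsOtherParent x w y → y ∈ otherParents x w
  ∈-otherParents⁺ {x} {w} {y} = ∈-filter⁺ (otherParent? x w) (∈-allFin y)

  ∈-otherParents⁻ : ∀ {x w y} → y ∈ otherParents x w → IsOtherParent x w y
  ∈-otherParents⁻ {x} {w} y∈ = proj₂ (∈-filter⁻ (otherParent? x w) {xs = allFin n} y∈)

  coParents : Fin n → List (Fin n)
  coParents x = concatMap (otherParents x) (outNbrs x)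

  -- x is one of the at most two in-neighbours of w, so any other one is
  -- unique: x followed by the other parents is a duplicate-free list of
  -- in-neighbours of w.
  otherParents-≤1 : ∀ {x w} → Arc D x w → indeg D w ≤ 2 → length (otherParents x w) ≤ 1
  otherParents-≤1 {x} {w} x→w indeg≤2 = ≤-pred (begin
    suc (length (otherParents x w))  ≤⟨ unique-⊆⇒length-≤ parents-unique (inNbrs w) parents-in ⟩
    length (inNbrs w)                ≡⟨ length-inNbrs w ⟩
    indeg D w                        ≤⟨ indeg≤2 ⟩
    2                                ∎)
    where
    open ≤-Reasoning
    parents-unique : Unique (x ∷ otherParents x w)
    parents-unique = All.tabulate (λ y∈ x≡y → proj₂ (∈-otherParents⁻ y∈) (≡-sym x≡y))
                   ∷ Unique.filter⁺ (otherParent? x w) (Unique.allFin⁺ n)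

    parents-in : ∀ {y} → y ∈ x ∷ otherParents x w → y ∈ inNbrs w
    parents-in (here refl) = ∈-inNbrs⁺ x→w
    parents-in (there y∈)  = ∈-inNbrs⁺ (proj₁ (∈-otherParents⁻ y∈))

  length-coParents : (∀ w → indeg D w ≤ 2) → ∀ x → length (coParents x) ≤ outdeg D x
  length-coParents indeg≤2 x =
    ≤-trans (length-concatMap-≤ (otherParents x) (outNbrs x)
               (λ {w} w∈out → otherParents-≤1 (∈-outNbrs⁻ w∈out) (indeg≤2 w)))
            (≤-reflexive (length-outNbrs x))

  -- A P(D)-neighbour inside S of a sink x of S cannot be an out-neighbour of
  -- x, so it is an in-neighbour or a co-parent of x.
  sink-neighbour : ∀ {S x y} → SinkOf D S x → T (S y) → PhyAdj D x y → y ∈ inNbrs x ++ coParents x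
  sink-neighbour (_ , noSucc) y∈S (_ , inj₁ x→y)        = ⊥-elim (noSucc _ y∈S x→y)
  sink-neighbour _            _   (_ , inj₂ (inj₁ y→x)) = ∈-++⁺ˡ (∈-inNbrs⁺ y→x)
  sink-neighbour {x = x} _    _   (x≢y , inj₂ (inj₂ (w , x→w , y→w))) =
    ∈-++⁺ʳ (inNbrs x) (∈-concatMap⁺ (otherParents x)
      (lose (∈-outNbrs⁺ x→w) (∈-otherParents⁺ (y→w , λ y≡x → x≢y (≡-sym y≡x)))))

  sink-phylogeny-degree : (∀ w → indeg D w ≤ 2) → ∀ {S x} → SinkOf D S x →
                          ∀ {ys} → Unique ys → (∀ {y} → y ∈ ys → T (S y) × PhyAdj D x y) →
                          length ys ≤ indeg D x + outdeg D x
  sink-phylogeny-degree indeg≤2 {S} {x} sink {ys} ys-unique ys-nbrs = begin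
    length ys                                 ≤⟨ unique-⊆⇒length-≤ ys-unique _ ys⊆ ⟩
    length (inNbrs x ++ coParents x)          ≡⟨ length-++ (inNbrs x) ⟩
    length (inNbrs x) + length (coParents x)  ≤⟨ +-mono-≤ (≤-reflexive (length-inNbrs x))
                                                          (length-coParents indeg≤2 x) ⟩
    indeg D x + outdeg D x                    ∎
    where
    open ≤-Reasoning
    ys⊆ : ∀ {y} → y ∈ ys → y ∈ inNbrs x ++ coParents x
    ys⊆ y∈ys = let (y∈S , adj) = ys-nbrs y∈ys in sink-neighbour sink y∈S adj

-- Transport along an isomorphism G ≅ P(D): the neighbours in a subgraph H of
-- the vertex corresponding to x become distinct P(D)-neighbours of x lying in
-- the image of V(H).
module _ {m n} {G : Graph m} (D : Digraph n) (iso : IsoToPhylogeny G D) (H : Subgraph G) where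

  open Inverse (proj₁ iso) using (to; from; strictlyInverseˡ; strictlyInverseʳ)

  image : Fin n → Bool
  image y = vset H (from y)

  to-∈image : ∀ {u} → T (vset H u) → T (image (to u))
  to-∈image {u} = subst (λ z → T (vset H z)) (≡-sym (strictlyInverseʳ u))

  imageNbrs : Fin n → List (Fin n)
  imageNbrs x = map to (filterᵇ (eset H (from x)) (allFin m))

  length-imageNbrs : ∀ x → length (imageNbrs x) ≡ degIn H (from x)
  length-imageNbrs x = begin
    length (imageNbrs x)                           ≡⟨ length-map to (filterᵇ (eset H (from x)) (allFin m)) ⟩
    length (filterᵇ (eset H (from x)) (allFin m))  ≡⟨ countB≡length-filter (eset H (from x)) ⟨
    degIn H (from x)                               ∎
    where open ≡-Reasoning

  imageNbrs-unique : ∀ x → Unique (imageNbrs x)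
  imageNbrs-unique x = Unique.map⁺ (Injection.injective (Inverse⇒Injection (proj₁ iso)))
                                   (Unique.filter⁺ (λ u → T? (eset H (from x) u)) (Unique.allFin⁺ m))

  imageNbrs-adjacent : ∀ {x y} → y ∈ imageNbrs x → T (image y) × PhyAdj D x y
  imageNbrs-adjacent {x} y∈ with ∈-map⁻ to y∈
  ... | u , u∈ , refl =
    to-∈image (proj₂ (ends H (from x) u edge)) ,
    subst (λ z → PhyAdj D z (to u)) (strictlyInverseˡ x) (proj₁ (proj₂ iso (from x) u) (sub H (from x) u edge))
    where
    edge : T (eset H (from x) u)
    edge = proj₂ (∈-filter⁻ (λ u → T? (eset H (from x) u)) {xs = allFin m} u∈)

-- Given a nonempty subgraph H of G ≅ P(D), a sink x of the image of V(H) in D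
-- corresponds to a vertex of H whose H-neighbours map to distinct P(D)-
-- neighbours of x in that image; there are at most indeg x + outdeg x ≤ 2 + j.
lemma3p8 : ∀ (j : ℕ) → 1 ≤ j → ∀ {m} (G : Graph m) →
    Is2jPhylogenyGraph j G → Degenerate (j + 2) G
lemma3p8 j _ G (n , D , (acyclic , degrees) , iso) H (u₀ , u₀∈H)
  with sink-exists D acyclic (image D iso H) (to-∈image D iso H u₀∈H)
... | x , sink = Inverse.from (proj₁ iso) x , proj₁ sink , (begin
  degIn H (Inverse.from (proj₁ iso) x)  ≡⟨ length-imageNbrs D iso H x ⟨
  length (imageNbrs D iso H x)          ≤⟨ sink-phylogeny-degree D (λ w → proj₁ (degrees w)) sink
                                             (imageNbrs-unique D iso H x) (imageNbrs-adjacent D iso H) ⟩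
  indeg D x + outdeg D x                ≤⟨ +-mono-≤ (proj₁ (degrees x)) (proj₂ (degrees x)) ⟩
  2 + j                                 ≡⟨ +-comm 2 j ⟩
  j + 2                                 ∎)
  where open ≤-Reasoning
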